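{- Let $I$ be a set, $\mathcal{U}$ an ultrafilter on $I$, $\mathbb{M}_i=\langle A_i,\cdot_i,D_i\rangle$ ($i\in I$) a family of $\Sigma$-Nmatrices, and $v_i\in\mathrm{Val}(\mathbb{M}_i)$ for each $i\in I$. Then there is a unique $v\in\mathrm{Val}(\Pi_{\mathcal{U}}\mathbb{M}_i)$ such that for each $\varphi\in Fm$ there exists $s_\varphi\in\Pi_{i\in I}A_i$ with $v(\varphi)=[s_\varphi]_{\mathcal{U}}$ and $\pi_i(s_\varphi)=v_i(\varphi)$ for all $i\in I$.
   Context: Fix a signature $\Sigma$, a denumerable set $P$ of variables and the set $Fm$ of formulas over $\Sigma$ and $P$. A $\Sigma$-Nmatrix is $\mathbb{M}=\langle A,\cdot_{\mathbb{M}},D\rangle$ where each $\copyright\in\Sigma^k$ is interpreted as $\copyright_{\mathbb{M}}:A^k\to\wp(A)\setminus\{\emptyset\}$ and $D\subseteq A$. A valuation is $v:Fm\to A$ with $v(\copyright(\varphi_1,\dots,\varphi_k))\in\copyright_{\mathbb{M}}(v(\varphi_1),\dots,v(\varphi_k))$; $\mathrm{Val}(\mathbb{M})$ is the set of valuations. The product of $\mathbb{M}_i$, $i\in I$, is $\langle\Pi_{i\in I}A_i,\cdot_I,\Pi_{i\in I}D_i\rangle$ with $\copyright_I(s_1,\dots,s_k)=\Pi_{i\in I}\copyright_i(\pi_i(s_1),\dots,\pi_i(s_k))$ ($\pi_i$ projections). The quotient of an Nmatrix $\langle A,\cdot,D\rangle$ by an equivalence $\equiv$ is $\langle A/{\equiv},\cdot_\equiv,\{[x]:x\in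 D\}\rangle$ with $\copyright_\equiv([x_1],\dots,[x_k])=\{[y]:y\in\copyright(y_1,\dots,y_k),\ y_j\equiv x_j\}$. For an ultrafilter $\mathcal{U}$ on $I$, $s\equiv_{\mathcal{U}}t$ iff $\{i:\pi_i(s)=\pi_i(t)\}\in\mathcal{U}$, $[s]_{\mathcal{U}}$ is the class of $s$, and the ultraproduct $\Pi_{\mathcal{U}}\mathbb{M}_i$ is the quotient of the product by $\equiv_{\mathcal{U}}$. -}

module Defs where

open import Data.Nat using (ℕ)
open import Data.Fin using (Fin)
open import Data.Product using (Σ; ∃; _×_; _,_; proj₁; proj₂)
open import Data.Sum using (_⊎_)
open import Data.Unit using (⊤; tt)
open import Data.Empty using (⊥)
open import Relation.Nullary using (¬_)
open import Relation.Binary.Core using (Rel)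
open import Relation.Binary.Structures using (IsEquivalence)
open import Relation.Binary.PropositionalEquality using (_≡_; refl; sym; trans)

-- A signature: Sg k is the set of k-ary connectives.
Signature : Set₁
Signature = ℕ → Set

data Fm (Sg : Signature) : Set where
  var : ℕ → Fm Sg
  app : ∀ {k} → Sg k → (Fin k → Fm Sg) → Fm Sg

-- A Σ-Nmatrix. Subsets of the carrier are predicates; each connective is
-- interpreted as a multifunction A^k → ℘(A) ∖ {∅}.
record Nmatrix (Sg : Signature) : Set₁ where
  field
    A        : Set
    op       : ∀ {k} → Sg k → (Fin k → A) → A → Set   -- op c xs y  :  y ∈ c_M(xs)
    nonempty : ∀ {k} (c : Sg k) (xs : Fin k → A) → ∃ (op c xs)
    D        : A → Set

open Nmatrix public

IsValuation : ∀ {Sg} (M : Nmatrix Sg) → (Fm Sg → A M) → Set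
IsValuation {Sg} M v = ∀ {k} (c : Sg k) (args : Fin k → Fm Sg) →
  op M c (λ j → v (args j)) (v (app c args))

Val : ∀ {Sg} → Nmatrix Sg → Set
Val {Sg} M = Σ (Fm Sg → A M) (IsValuation M)

ΠN : ∀ {Sg} {I : Set} → (I → Nmatrix Sg) → Nmatrix Sg
ΠN {Sg} {I} M = record
  { A        = (i : I) → A (M i)
  ; op       = λ c ss t → (i : I) → op (M i) c (λ j → ss j i) (t i)
  ; nonempty = λ c ss → (λ i → proj₁ (nonempty (M i) c (λ j → ss j i)))
                      , (λ i → proj₂ (nonempty (M i) c (λ j → ss j i)))
  ; D        = λ t → (i : I) → D (M i) (t i)
  }

-- Quotient of an Nmatrix by an equivalence relation ≈, represented as a
-- setoid: the carrier is kept and elements are read as representatives of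
-- their ≈-classes.  [t] ∈ c_≈([x1],...,[xk]) iff t ≈ y for some y ∈ c(y1..yk)
-- with yj ≈ xj; [t] is designated iff t ≈ x for some x ∈ D.
Quotient : ∀ {Sg} (M : Nmatrix Sg) (_≈_ : Rel (A M) _) → IsEquivalence _≈_ → Nmatrix Sg
Quotient {Sg} M _≈_ eq = record
  { A        = A M
  ; op       = λ {k} c xs t → Σ (Fin k → A M) λ ys → Σ (A M) λ y →
                 ((j : Fin k) → ys j ≈ xs j) × op M c ys y × (y ≈ t)
  ; nonempty = λ c xs → let (y , p) = nonempty M c xs in
                 y , xs , y , (λ j → IsEquivalence.refl eq) , p , IsEquivalence.refl eq
  ; D        = λ t → Σ (A M) λ x → D M x × (x ≈ t)
  }

record IsUltrafilter {I : Set} (U : (I → Set) → Set) : Set₁ where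
  field
    whole  : U (λ _ → ⊤)
    proper : ¬ U (λ _ → ⊥)
    upward : ∀ {X Y : I → Set} → (∀ i → X i → Y i) → U X → U Y
    meet   : ∀ {X Y : I → Set} → U X → U Y → U (λ i → X i × Y i)
    ultra  : ∀ (X : I → Set) → U X ⊎ U (λ i → ¬ X i)

≡U : ∀ {I : Set} (U : (I → Set) → Set) {B : I → Set} → Rel ((i : I) → B i) _
≡U U s t = U (λ i → s i ≡ t i)

≡U-isEquivalence : ∀ {I : Set} {U : (I → Set) → Set} → IsUltrafilter U →
  {B : I → Set} → IsEquivalence (≡U U {B})
≡U-isEquivalence uf = record
  { refl  = upward (λ i _ → refl) whole
  ; sym   = upward (λ i → sym)
  ; trans = λ p q → upward (λ i pq → trans (proj₁ pq) (proj₂ pq)) (meet p q)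
  }
  where open IsUltrafilter uf

Ultraproduct : ∀ {Sg} {I : Set} {U : (I → Set) → Set} → IsUltrafilter U →
  (I → Nmatrix Sg) → Nmatrix Sg
Ultraproduct {U = U} uf M = Quotient (ΠN M) (≡U U) (≡U-isEquivalence uf)

{-# OPTIONS --safe #-}
module Submission where

open import Defs
open import Data.Product using (Σ; _×_; proj₁; proj₂; _,_)
open import Relation.Binary.Core using (Rel)
open import Relation.Binary.Structures using (IsEquivalence)
open import Relation.Binary.PropositionalEquality using (_≡_; refl; trans)

-- The pointwise valuation φ ↦ (v_i(φ))_i is a valuation of the product, and every
-- valuation of an Nmatrix remains one of each of its quotients; taking s_φ to be that
-- same tuple gives existence. Uniqueness is forced because s_φ is determined
-- pointwise, so any other such valuation agrees with it up to ≡U.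

ΠN-pointwise-val : ∀ {Sg} {I : Set} (M : I → Nmatrix Sg) → ((i : I) → Val (M i)) → Val (ΠN M)
ΠN-pointwise-val M vs = (λ φ i → proj₁ (vs i) φ) , (λ c args i → proj₂ (vs i) c args)

Quotient-val : ∀ {Sg} (M : Nmatrix Sg) (_≈_ : Rel (A M) _) (eq : IsEquivalence _≈_) →
  Val M → Val (Quotient M _≈_ eq)
Quotient-val M _≈_ eq (v , isVal) =
  v , λ c args → (λ j → v (args j)) , v (app c args) , (λ j → ≈-refl) , isVal c args , ≈-refl
  where open IsEquivalence eq renaming (refl to ≈-refl)

module _ {I : Set} {U : (I → Set) → Set} (uf : IsUltrafilter U) {B : I → Set} where
  open IsUltrafilter uf

  ≡⇒≡U : {s t : (i : I) → B i} → ((i : I) → s i ≡ t i) → ≡U U s t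
  ≡⇒≡U s≡t = upward (λ i _ → s≡t i) whole

  ≡U-respʳ-≡ : {r s t : (i : I) → B i} → ≡U U r s → ((i : I) → s i ≡ t i) → ≡U U r t
  ≡U-respʳ-≡ r≡Us s≡t = upward (λ i r≡s → trans r≡s (s≡t i)) r≡Us

proposition27 : ∀ {Sg : Signature} (I : Set) (U : (I → Set) → Set) (uf : IsUltrafilter U)
    (M : I → Nmatrix Sg) (vs : (i : I) → Val (M i)) →
    Σ (Val (Ultraproduct uf M)) λ v →
      ((φ : Fm Sg) → Σ ((i : I) → A (M i)) λ s →
         ≡U U (proj₁ v φ) s × ((i : I) → s i ≡ proj₁ (vs i) φ))
      × ((w : Val (Ultraproduct uf M)) →
         ((φ : Fm Sg) → Σ ((i : I) → A (M i)) λ s →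
            ≡U U (proj₁ w φ) s × ((i : I) → s i ≡ proj₁ (vs i) φ)) →
         (φ : Fm Sg) → ≡U U (proj₁ w φ) (proj₁ v φ))
proposition27 I U uf M vs = v , represented , unique
  where
  v : Val (Ultraproduct uf M)
  v = Quotient-val (ΠN M) (≡U U) (≡U-isEquivalence uf) (ΠN-pointwise-val M vs)

  Represented : Val (Ultraproduct uf M) → Set
  Represented w = (φ : Fm _) → Σ ((i : I) → A (M i)) λ s →
    ≡U U (proj₁ w φ) s × ((i : I) → s i ≡ proj₁ (vs i) φ)

  represented : Represented v
  represented φ = proj₁ v φ , ≡⇒≡U uf (λ i → refl) , (λ i → refl)

  unique : (w : Val (Ultraproduct uf M)) → Represented w → (φ : Fm _) → ≡U U (proj₁ w φ) (proj₁ v φ)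
  unique w w-represented φ with w-represented φ
  ... | s , w≡Us , s≡vs = ≡U-respʳ-≡ uf w≡Us s≡vs
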